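{- Let $q\geq 3$ and $2\leq k-1\leq\frac{q}{3+\log q}$ (logarithm to base $2$). Then there exist (i) a connected graph $G\in\mathcal{TW}_{k-1}\cap\mathcal{TD}_q$ such that Robber wins $\mathrm{CR}^k_q(G)$, and (ii) a connected graph $G'\in\mathcal{TW}_1\cap\mathcal{TD}_q$ such that Robber wins $\mathrm{CR}^2_q(G')$.
   Context: $\mathcal{TW}_k$: graphs of treewidth at most $k$; $\mathcal{TD}_q$: graphs of treedepth at most $q$. The non-monotone $q$-round $k$-cops-and-robber game $\mathrm{CR}^k_q(G)$ is played on $G'$, obtained from $G$ by adding a disjoint $k$-clique $K$. Cop positions are $k$-subsets $X\subseteq V(G')$; the robber occupies a vertex of $G$. Initially cops are on $K$ and Robber picks any vertex of $G$. In round $i\leq q$ (cops on $X_i$, robber on $v_i$): Cops chooses $X_{i+1}$ with $|X_i\cap X_{i+1}|=k-1$; Robber moves along a path from $v_i$ to some $v_{i+1}$ with no inner vertex in $X_i\cap X_{i+1}$; Cops wins if $v_{i+1}\in X_{i+1}$. Robber wins (has a winning strategy) if he can ensure Cops has not won after $q$ rounds. -}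

module Defs where

open import Data.Nat using (ℕ; zero; suc; _+_; _∸_; _≤_)
open import Data.Fin using (Fin; _↑ˡ_; splitAt; inject₁; fromℕ) renaming (zero to fzero; suc to fsuc)
open import Data.Fin.Subset using (Subset; _∈_; _∉_; ∣_∣; _∩_)
open import Data.Vec using (replicate; _++_)
open import Data.Bool using (Bool; true; false; T)
open import Data.Maybe using (Maybe; just; nothing)
open import Data.Product using (Σ; ∃; _×_)
open import Data.Sum using (_⊎_; inj₁; inj₂)
open import Data.Unit using (⊤)
open import Data.Empty using (⊥)
open import Function.Definitions using (Injective)
open import Relation.Binary.PropositionalEquality using (_≡_; _≢_)

record Graph (n : ℕ) : Set where
  field
    adj        : Fin n → Fin n → Bool
    adj-sym    : ∀ u v → adj u v ≡ adj v u
    adj-irrefl : ∀ v → adj v v ≡ false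

Adj : ∀ {n} → Graph n → Fin n → Fin n → Set
Adj G u v = T (Graph.adj G u v)

-- Walks from u to w along the edge relation E whose inner vertices all satisfy P
-- (the endpoints are unconstrained).  A walk with this property exists iff a path
-- with this property exists.
data Walk {n : ℕ} (E : Fin n → Fin n → Set) (P : Fin n → Set) : Fin n → Fin n → Set where
  stay : ∀ {v} → Walk E P v v
  edge : ∀ {u v} → E u v → Walk E P u v
  step : ∀ {u v w} → E u v → P v → Walk E P v w → Walk E P u w

Connected : ∀ {n} → Graph n → Set
Connected G = ∀ u v → Walk (Adj G) (λ _ → ⊤) u v

Cycle : ∀ {m} → Graph m → Set
Cycle {m} T' = Σ ℕ λ l → Σ (Fin (suc (suc (suc l))) → Fin m) λ c →
  Injective _≡_ _≡_ c
  × (∀ (i : Fin (suc (suc l))) → Adj T' (c (inject₁ i)) (c (fsuc i)))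
  × Adj T' (c (fromℕ (suc (suc l)))) (c fzero)

Acyclic : ∀ {m} → Graph m → Set
Acyclic T' = Cycle T' → ⊥

-- Tree decomposition of G of width at most k (all bags of size ≤ k+1).
-- G ∈ TW_k  iff  TreeDecomposition G k is inhabited.
record TreeDecomposition {n : ℕ} (G : Graph n) (k : ℕ) : Set where
  field
    m              : ℕ
    tree           : Graph m
    tree-connected : Connected tree
    tree-acyclic   : Acyclic tree
    bag            : Fin m → Subset n
    bag-size       : ∀ t → ∣ bag t ∣ ≤ suc k
    vertex-cover   : ∀ v → ∃ λ t → v ∈ bag t
    edge-cover     : ∀ u v → Adj G u v → ∃ λ t → (u ∈ bag t × v ∈ bag t)
    -- the tree nodes whose bags contain v induce a connected subtree
    coherence      : ∀ v t₁ t₂ → v ∈ bag t₁ → v ∈ bag t₂ →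
                     Walk (Adj tree) (λ t → v ∈ bag t) t₁ t₂

data Ancestor {n : ℕ} (parent : Fin n → Maybe (Fin n)) : Fin n → Fin n → Set where
  self : ∀ {u} → Ancestor parent u u
  up   : ∀ {u v p} → parent v ≡ just p → Ancestor parent u p → Ancestor parent u v

-- Treedepth: G ∈ TD_q iff there is a rooted forest on V(G) of height ≤ q
-- (height = number of vertices on a longest root-to-leaf path) whose closure contains G.
record ElimForest {n : ℕ} (G : Graph n) (q : ℕ) : Set where
  field
    parent      : Fin n → Maybe (Fin n)
    depth       : Fin n → ℕ
    depth-root  : ∀ v → parent v ≡ nothing → depth v ≡ 1
    depth-child : ∀ v p → parent v ≡ just p → depth v ≡ suc (depth p)
    depth-bound : ∀ v → depth v ≤ q
    edges-comparable : ∀ u v → Adj G u v → Ancestor parent u v ⊎ Ancestor parent v u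

-- The game CR^k_q(G), played on G' = G + disjoint k-clique K, vertex set Fin (n + k)
-- (first n vertices = G via _↑ˡ k, last k = K).
module _ {n : ℕ} (G : Graph n) (k : ℕ) where

  AdjSum : Fin n ⊎ Fin k → Fin n ⊎ Fin k → Set
  AdjSum (inj₁ a) (inj₁ b) = Adj G a b
  AdjSum (inj₂ a) (inj₂ b) = a ≢ b
  AdjSum (inj₁ a) (inj₂ b) = ⊥
  AdjSum (inj₂ a) (inj₁ b) = ⊥

  AdjG' : Fin (n + k) → Fin (n + k) → Set
  AdjG' u v = AdjSum (splitAt n u) (splitAt n v)

  cliqueK : Subset (n + k)
  cliqueK = replicate n false ++ replicate k true

  RobberSurvives : ℕ → Subset (n + k) → Fin n → Set
  RobberSurvives zero    X v = ⊤
  RobberSurvives (suc r) X v =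
    ∀ (Y : Subset (n + k)) → ∣ Y ∣ ≡ k → ∣ X ∩ Y ∣ ≡ k ∸ 1 →
      Σ (Fin n) λ w →
        Walk AdjG' (λ x → x ∉ X ∩ Y) (v ↑ˡ k) (w ↑ˡ k)
        × (w ↑ˡ k) ∉ Y
        × RobberSurvives r Y w

  RobberWins : ℕ → Set
  RobberWins q = Σ (Fin n) λ v → RobberSurvives q cliqueK v

{-# OPTIONS --safe #-}
-- Take a path P_N with N = 2^e − 1 vertices and add m = k − 2 apices, adjacent to each other and to
-- everything else.  Bags {t − 1, t} ∪ apices along the path give width m + 1.  Stacking the apices
-- as a chain on top of the in-order perfect binary tree of P_N gives an elimination forest of height
-- m + e.  With k = m + 2 cops at most m + 1 of them stay put in a round, so the robber, sitting on the
-- path, either is not threatened, or can step to a path neighbour that remains free, or both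
-- neighbours are blocked and then some apex is free, through which he jumps into a window of k + 1
-- fixed path vertices, one of which is not occupied.  Keeping at distance ≥ r from both ends of the
-- path with r rounds to go, he survives q rounds once N ≥ 2q + k; the hypothesis (8q)^(k−1) ≤ 2^q
-- gives this both for m = k − 2, e = q − m and for m = 0, e = q.
module Submission where

open import Data.Bool using (false; T)
open import Data.Bool.Properties using (T-≡)
open import Data.Fin using (Fin; toℕ; fromℕ<; fromℕ; inject₁; _↑ˡ_; _↑ʳ_; splitAt)
  renaming (zero to fzero; suc to fsuc)
import Data.Fin.Properties as FinP
open import Data.Fin.Relation.Unary.Top using (view; ‵fromℕ; ‵inj₁)
open import Data.Fin.Subset using (Subset; _∈_; _∉_; ∣_∣; _∩_; ∁; ⁅_⁆; _-_; _⊆_; _⊂_; inside; outside)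
open import Data.Fin.Subset.Properties
  using (x∈p∧x≢y⇒x∈p-y; x∈p⇒∣p-x∣<∣p∣; p⊂q⇒∣p∣<∣q∣; Empty-unique; ∣⊥∣≡0; ∣⁅x⁆∣≡1; x∈⁅x⁆; x∈∁p⇒x∉p;
         _∈?_; x∈p∩q⁻)
open import Data.Maybe using (Maybe; just; nothing)
open import Data.Maybe.Properties using (just-injective)
open import Data.Nat using (ℕ; zero; suc; pred; >-nonZero; _+_; _*_; _∸_; _^_; _≤_; _<_; z≤n; s≤s)
open import Data.Nat.Properties
open import Data.Nat.Tactic.RingSolver using (solve-∀)
open import Data.Product using (Σ; ∃; _×_; _,_; proj₁; proj₂)
import Data.Product
open import Data.Sum using (_⊎_; inj₁; inj₂)
import Data.Sum
open import Data.Unit using (tt)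
open import Data.Vec using ([]; _∷_; tabulate; replicate)
open import Data.Vec.Properties using (lookup∘tabulate; lookup⇒[]=; []=⇒lookup; lookup-++ˡ; lookup-replicate)
open import Function using (_∘_)
open import Function.Bundles using (Equivalence)
open import Function.Definitions using (Injective)
open import Relation.Binary using (Decidable; Symmetric; tri<; tri≈; tri>)
open import Relation.Binary.PropositionalEquality
open import Relation.Nullary using (¬_; Dec; yes; no; contradiction)
open import Relation.Nullary.Decidable using (isYes; toWitness; fromWitness; ¬?; _×-dec_; _⊎-dec_)

open import Defs

∣p∣≤∣q∣+∣p∩∁q∣ : ∀ {n} (p q : Subset n) → ∣ p ∣ ≤ ∣ q ∣ + ∣ p ∩ ∁ q ∣
∣p∣≤∣q∣+∣p∩∁q∣ []            []            = z≤n
∣p∣≤∣q∣+∣p∩∁q∣ (inside  ∷ p) (inside  ∷ q) = s≤s (∣p∣≤∣q∣+∣p∩∁q∣ p q)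
∣p∣≤∣q∣+∣p∩∁q∣ (inside  ∷ p) (outside ∷ q) =
  subst (suc ∣ p ∣ ≤_) (sym (+-suc ∣ q ∣ _)) (s≤s (∣p∣≤∣q∣+∣p∩∁q∣ p q))
∣p∣≤∣q∣+∣p∩∁q∣ (outside ∷ p) (inside  ∷ q) = m≤n⇒m≤1+n (∣p∣≤∣q∣+∣p∩∁q∣ p q)
∣p∣≤∣q∣+∣p∩∁q∣ (outside ∷ p) (outside ∷ q) = ∣p∣≤∣q∣+∣p∩∁q∣ p q

covered⇒∣p∣≤ : ∀ {j n} (p : Subset n) (f : Fin j → Fin n) →
  (∀ {x} → x ∈ p → ∃ λ i → f i ≡ x) → ∣ p ∣ ≤ j
covered⇒∣p∣≤ {zero} {n} p f cover =
  ≤-reflexive (trans (cong ∣_∣ (Empty-unique λ (_ , x∈p) → FinP.¬Fin0 (proj₁ (cover x∈p)))) (∣⊥∣≡0 n))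
covered⇒∣p∣≤ {suc j} p f cover = begin
  ∣ p ∣                      ≤⟨ ∣p∣≤∣q∣+∣p∩∁q∣ p ⁅ f fzero ⁆ ⟩
  ∣ ⁅ f fzero ⁆ ∣ + ∣ rest ∣ ≡⟨ cong (_+ ∣ rest ∣) (∣⁅x⁆∣≡1 (f fzero)) ⟩
  suc ∣ rest ∣               ≤⟨ s≤s (covered⇒∣p∣≤ rest (f ∘ fsuc) cover-rest) ⟩
  suc j                      ∎
  where
  open ≤-Reasoning
  rest : Subset _
  rest = p ∩ ∁ ⁅ f fzero ⁆
  cover-rest : ∀ {x} → x ∈ rest → ∃ λ i → f (fsuc i) ≡ x
  cover-rest x∈rest with x∈p∩q⁻ p _ x∈rest
  ... | x∈p , x∉f₀ with cover x∈p
  ...   | fzero  , refl = contradiction (x∈⁅x⁆ (f fzero)) (x∈∁p⇒x∉p x∉f₀)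
  ...   | fsuc i , fi≡x = i , fi≡x

injection⇒≤∣p∣ : ∀ {j n} (p : Subset n) (f : Fin j → Fin n) → Injective _≡_ _≡_ f →
  (∀ i → f i ∈ p) → j ≤ ∣ p ∣
injection⇒≤∣p∣ {zero}  p f f-inj f∈p = z≤n
injection⇒≤∣p∣ {suc j} p f f-inj f∈p =
  ≤-trans (s≤s (injection⇒≤∣p∣ (p - f fzero) (f ∘ fsuc) (FinP.suc-injective ∘ f-inj) f∘suc∈p-f₀))
          (x∈p⇒∣p-x∣<∣p∣ (f∈p fzero))
  where
  f∘suc∈p-f₀ : ∀ i → f (fsuc i) ∈ p - f fzero
  f∘suc∈p-f₀ i = x∈p∧x≢y⇒x∈p-y (f∈p (fsuc i)) (λ e → FinP.0≢1+n (sym (f-inj e)))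

injection-misses : ∀ {j n} (p : Subset n) (f : Fin j → Fin n) → Injective _≡_ _≡_ f →
  ∣ p ∣ < j → ∃ λ i → f i ∉ p
injection-misses p f f-inj ∣p∣<j with FinP.all? (λ i → f i ∈? p)
... | yes f∈p = contradiction (injection⇒≤∣p∣ p f f-inj f∈p) (<⇒≱ ∣p∣<j)
... | no ¬f∈p = FinP.¬∀⟶∃¬ _ _ (λ i → f i ∈? p) ¬f∈p

∉X∩Y⇒∉Y : ∀ {n s} {X Y : Subset n} {u w} → ∣ Y ∣ ≡ suc s → ∣ X ∩ Y ∣ ≡ s →
  w ∈ Y → w ∉ X → u ≢ w → u ∉ X ∩ Y → u ∉ Y
∉X∩Y⇒∉Y {s = s} {X} {Y} {u} {w} ∣Y∣≡1+s ∣X∩Y∣≡s w∈Y w∉X u≢w u∉X∩Y u∈Y =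
  <-irrefl refl (begin-strict
    suc s          ≡⟨ cong suc (sym ∣X∩Y∣≡s) ⟩
    suc ∣ X ∩ Y ∣  ≤⟨ p⊂q⇒∣p∣<∣q∣ X∩Y⊂Y-w ⟩
    ∣ Y - w ∣      <⟨ x∈p⇒∣p-x∣<∣p∣ w∈Y ⟩
    ∣ Y ∣          ≡⟨ ∣Y∣≡1+s ⟩
    suc s          ∎)
  where
  open ≤-Reasoning
  X∩Y⊆Y-w : X ∩ Y ⊆ Y - w
  X∩Y⊆Y-w x∈X∩Y with x∈p∩q⁻ X Y x∈X∩Y
  ... | x∈X , x∈Y = x∈p∧x≢y⇒x∈p-y x∈Y λ { refl → w∉X x∈X }
  X∩Y⊂Y-w : X ∩ Y ⊂ Y - w
  X∩Y⊂Y-w = X∩Y⊆Y-w , u , x∈p∧x≢y⇒x∈p-y u∈Y u≢w , u∉X∩Y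

module _ {n} {P : Fin n → Set} (P? : ∀ x → Dec (P x)) where

  subsetOf : Subset n
  subsetOf = tabulate (isYes ∘ P?)

  ∈-subsetOf⁺ : ∀ {x} → P x → x ∈ subsetOf
  ∈-subsetOf⁺ {x} px = lookup⇒[]= x subsetOf (trans (lookup∘tabulate _ x) (Equivalence.to T-≡ (fromWitness px)))

  ∈-subsetOf⁻ : ∀ {x} → x ∈ subsetOf → P x
  ∈-subsetOf⁻ {x} x∈ = toWitness (Equivalence.from T-≡ (trans (sym (lookup∘tabulate _ x)) ([]=⇒lookup x∈)))

module _ {n} {E : Fin n → Fin n → Set} {P : Fin n → Set} where

  snoc : ∀ {u v w} → Walk E P u v → P v → E v w → Walk E P u w
  snoc stay            _  e = edge e
  snoc (edge e′)       pv e = step e′ pv (edge e)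
  snoc (step e′ pu uv) pv e = step e′ pu (snoc uv pv e)

  reverse : (∀ {u v} → E u v → E v u) → ∀ {u v} → Walk E P u v → Walk E P v u
  reverse E-sym stay          = stay
  reverse E-sym (edge e)      = edge (E-sym e)
  reverse E-sym (step e pv w) = snoc (reverse E-sym w) pv (E-sym e)

  module _ (B : ℕ) (E-sym : ∀ {u v} → E u v → E v u)
           (E-next : ∀ {u v} → suc (toℕ u) ≡ toℕ v → toℕ v < B → E u v)
           (P-below : ∀ {u} → toℕ u < B → P u) where

    walk-up : ∀ d {u v} → toℕ u + d ≡ toℕ v → toℕ v < B → Walk E P u v
    walk-up zero {u} u+0≡v _ =
      subst (Walk E P u) (FinP.toℕ-injective (trans (sym (+-identityʳ _)) u+0≡v)) stay
    walk-up (suc d) {u} {v} u+1+d≡v v<B =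
      step (E-next (sym toℕ-u′) u′<B) (P-below u′<B) (walk-up d u′+d≡v v<B)
      where
      1+u≤v : suc (toℕ u) ≤ toℕ v
      1+u≤v = subst (suc (toℕ u) ≤_) (trans (sym (+-suc (toℕ u) d)) u+1+d≡v) (s≤s (m≤m+n (toℕ u) d))
      u′ : Fin n
      u′ = fromℕ< (≤-<-trans 1+u≤v (FinP.toℕ<n v))
      toℕ-u′ : toℕ u′ ≡ suc (toℕ u)
      toℕ-u′ = FinP.toℕ-fromℕ< _
      u′<B : toℕ u′ < B
      u′<B = subst (_< B) (sym toℕ-u′) (≤-<-trans 1+u≤v v<B)
      u′+d≡v : toℕ u′ + d ≡ toℕ v
      u′+d≡v = trans (cong (_+ d) toℕ-u′) (trans (sym (+-suc (toℕ u) d)) u+1+d≡v)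

    walk-below : ∀ {u v} → toℕ u < B → toℕ v < B → Walk E P u v
    walk-below {u} {v} u<B v<B with ≤-total (toℕ u) (toℕ v)
    ... | inj₁ u≤v = walk-up _ (m+[n∸m]≡n u≤v) v<B
    ... | inj₂ v≤u = reverse E-sym (walk-up _ (m+[n∸m]≡n v≤u) u<B)

Adj-sym : ∀ {n} (G : Graph n) {u v} → Adj G u v → Adj G v u
Adj-sym G {u} {v} = subst T (Graph.adj-sym G u v)

module _ {n} {R : Fin n → Fin n → Set} (R? : Decidable R) (R-sym : Symmetric R) (R-irrefl : ∀ {v} → ¬ R v v)
  where

  relationGraph : Graph n
  relationGraph = record { adj = λ u v → isYes (R? u v) ; adj-sym = adj-sym ; adj-irrefl = adj-irrefl }
    where
    adj-sym : ∀ u v → isYes (R? u v) ≡ isYes (R? v u)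
    adj-sym u v with R? u v | R? v u
    ... | yes _   | yes _   = refl
    ... | no  _   | no  _   = refl
    ... | yes uRv | no ¬vRu = contradiction (R-sym uRv) ¬vRu
    ... | no ¬uRv | yes vRu = contradiction (R-sym vRu) ¬uRv
    adj-irrefl : ∀ v → isYes (R? v v) ≡ false
    adj-irrefl v with R? v v
    ... | yes vRv = contradiction vRv R-irrefl
    ... | no  _   = refl

  adj⇒R : ∀ {u v} → Adj relationGraph u v → R u v
  adj⇒R = toWitness

  R⇒adj : ∀ {u v} → R u v → Adj relationGraph u v
  R⇒adj = fromWitness

Consecutive : ℕ → ℕ → Set
Consecutive i j = suc i ≡ j ⊎ suc j ≡ i

consecutive? : Decidable Consecutive
consecutive? i j = (suc i ≟ j) ⊎-dec (suc j ≟ i)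

consecutive-sym : ∀ {i j} → Consecutive i j → Consecutive j i
consecutive-sym = Data.Sum.swap

consecutive-irrefl : ∀ {i} → ¬ Consecutive i i
consecutive-irrefl (inj₁ 1+i≡i) = 1+n≢n 1+i≡i
consecutive-irrefl (inj₂ 1+i≡i) = 1+n≢n 1+i≡i

consecutive-≤⇒suc : ∀ {i j} → Consecutive i j → i ≤ j → suc i ≡ j
consecutive-≤⇒suc (inj₁ 1+i≡j) _   = 1+i≡j
consecutive-≤⇒suc (inj₂ refl)  i≤j = contradiction i≤j 1+n≰n

argmax : ∀ {L} (f : Fin (suc L) → ℕ) → ∃ λ a → ∀ b → f b ≤ f a
argmax {zero}  f = fzero , λ { fzero → ≤-refl }
argmax {suc L} f with argmax (f ∘ fsuc)
... | a , max with f fzero ≤? f (fsuc a)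
...   | yes f₀≤ = fsuc a , λ { fzero → f₀≤ ; (fsuc b) → max b }
...   | no  f₀≰ = fzero  , λ { fzero → ≤-refl ; (fsuc b) → ≤-trans (max b) (<⇒≤ (≰⇒> f₀≰)) }

module _ {M} (T′ : Graph M) where

  cycle-neighbours : ∀ {l} (c : Fin (suc (suc (suc l))) → Fin M) →
    (∀ (i : Fin (suc (suc l))) → Adj T′ (c (inject₁ i)) (c (fsuc i))) →
    Adj T′ (c (fromℕ (suc (suc l)))) (c fzero) →
    ∀ a → ∃ λ b → ∃ λ b′ → b ≢ b′ × Adj T′ (c b) (c a) × Adj T′ (c b′) (c a)
  cycle-neighbours c next close fzero =
    fsuc fzero , fromℕ _ , (λ ()) , Adj-sym T′ (next fzero) , close
  cycle-neighbours c next close (fsuc i) with view i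
  ... | ‵fromℕ   = inject₁ (fromℕ _) , fzero , (λ ()) , next (fromℕ _) , Adj-sym T′ close
  ... | ‵inj₁ {i = j} _ =
    inject₁ (inject₁ j) , fsuc (fsuc j) , two-apart , next (inject₁ j) , Adj-sym T′ (next (fsuc j))
    where
    two-apart : inject₁ (inject₁ j) ≢ fsuc (fsuc j)
    two-apart eq = <⇒≢ (n≤1+n (suc (toℕ j)))
      (trans (sym (trans (FinP.toℕ-inject₁ _) (FinP.toℕ-inject₁ j))) (cong toℕ eq))

  -- The two cycle neighbours of a vertex with maximal label would both carry that label minus one.
  consecutive-labels⇒acyclic : (∀ {u v} → Adj T′ u v → Consecutive (toℕ u) (toℕ v)) → Acyclic T′
  consecutive-labels⇒acyclic consecutive (l , c , c-inj , next , close) with argmax (toℕ ∘ c)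
  ... | a , max with cycle-neighbours c next close a
  ...   | b , b′ , b≢b′ , b~a , b′~a = b≢b′ (c-inj (FinP.toℕ-injective (suc-injective (trans
            (consecutive-≤⇒suc (consecutive b~a) (max b))
            (sym (consecutive-≤⇒suc (consecutive b′~a) (max b′)))))))

consecutiveLabels? : ∀ {n} → Decidable (λ (u v : Fin n) → Consecutive (toℕ u) (toℕ v))
consecutiveLabels? u v = consecutive? (toℕ u) (toℕ v)

pathGraph : ∀ n → Graph n
pathGraph n = relationGraph consecutiveLabels? consecutive-sym consecutive-irrefl

module _ {n : ℕ} where

  pathGraph-adj⁺ : ∀ {u v} → Consecutive (toℕ u) (toℕ v) → Adj (pathGraph n) u v
  pathGraph-adj⁺ = R⇒adj consecutiveLabels? consecutive-sym consecutive-irrefl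

  pathGraph-adj⁻ : ∀ {u v} → Adj (pathGraph n) u v → Consecutive (toℕ u) (toℕ v)
  pathGraph-adj⁻ = adj⇒R consecutiveLabels? consecutive-sym consecutive-irrefl

  pathGraph-walk : ∀ {P : Fin n → Set} → (∀ {t} → P t) → ∀ s t → Walk (Adj (pathGraph n)) P s t
  pathGraph-walk P-all s t =
    walk-below n (Adj-sym (pathGraph n)) (λ 1+s≡t _ → pathGraph-adj⁺ (inj₁ 1+s≡t)) (λ _ → P-all)
               (FinP.toℕ<n s) (FinP.toℕ<n t)

  pathGraph-acyclic : Acyclic (pathGraph n)
  pathGraph-acyclic = consecutive-labels⇒acyclic (pathGraph n) pathGraph-adj⁻

module ApexPath (N m : ℕ) where

  Edge : ℕ → ℕ → Set
  Edge i j = i ≢ j × ((N ≤ i ⊎ N ≤ j) ⊎ Consecutive i j)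

  edge? : Decidable Edge
  edge? i j = ¬? (i ≟ j) ×-dec ((N ≤? i ⊎-dec N ≤? j) ⊎-dec consecutive? i j)

  edge-sym : ∀ {i j} → Edge i j → Edge j i
  edge-sym (i≢j , inj₁ (inj₁ N≤i)) = i≢j ∘ sym , inj₁ (inj₂ N≤i)
  edge-sym (i≢j , inj₁ (inj₂ N≤j)) = i≢j ∘ sym , inj₁ (inj₁ N≤j)
  edge-sym (i≢j , inj₂ i~j)        = i≢j ∘ sym , inj₂ (consecutive-sym i~j)

  edge-irrefl : ∀ {i} → ¬ Edge i i
  edge-irrefl (i≢i , _) = i≢i refl

  labelEdge? : Decidable (λ (u v : Fin (N + m)) → Edge (toℕ u) (toℕ v))
  labelEdge? u v = edge? (toℕ u) (toℕ v)

  graph : Graph (N + m)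
  graph = relationGraph labelEdge? edge-sym edge-irrefl

  adj⇒edge : ∀ {u v} → Adj graph u v → Edge (toℕ u) (toℕ v)
  adj⇒edge = adj⇒R labelEdge? edge-sym edge-irrefl

  edge⇒adj : ∀ {u v} → Edge (toℕ u) (toℕ v) → Adj graph u v
  edge⇒adj = R⇒adj labelEdge? edge-sym edge-irrefl

  consecutive⇒adj : ∀ {u v} → Consecutive (toℕ u) (toℕ v) → Adj graph u v
  consecutive⇒adj u~v = edge⇒adj ((λ u≡v → consecutive-irrefl (subst (Consecutive _) (sym u≡v) u~v)) , inj₂ u~v)

  pathVertex : ∀ {i} → i < N → Fin (N + m)
  pathVertex i<N = fromℕ< (<-≤-trans i<N (m≤m+n N m))

  toℕ-pathVertex : ∀ {i} (i<N : i < N) → toℕ (pathVertex i<N) ≡ i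
  toℕ-pathVertex _ = FinP.toℕ-fromℕ< _

  toℕ-pathVertex<N : ∀ {i} (i<N : i < N) → toℕ (pathVertex i<N) < N
  toℕ-pathVertex<N i<N = subst (_< N) (sym (toℕ-pathVertex i<N)) i<N

  pathVertex-≡ : ∀ {i v} (i<N : i < N) → i ≡ toℕ v → pathVertex i<N ≡ v
  pathVertex-≡ i<N i≡v = FinP.toℕ-injective (trans (toℕ-pathVertex i<N) i≡v)

  apex : Fin m → Fin (N + m)
  apex a = N ↑ʳ a

  N≤apex : ∀ a → N ≤ toℕ (apex a)
  N≤apex a = subst (N ≤_) (sym (FinP.toℕ-↑ʳ N a)) (m≤m+n N (toℕ a))

  apex-view : ∀ v → N ≤ toℕ v → ∃ λ a → apex a ≡ v
  apex-view v N≤v with splitAt N v in eq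
  ... | inj₂ a = a , FinP.splitAt⁻¹-↑ʳ eq
  ... | inj₁ i = contradiction N≤v (<⇒≱ (subst (_< N) i≡v (FinP.toℕ<n i)))
    where
    i≡v : toℕ i ≡ toℕ v
    i≡v = trans (sym (FinP.toℕ-↑ˡ i m)) (cong toℕ (FinP.splitAt⁻¹-↑ˡ eq))

  path-apex-adj : ∀ {u} a → toℕ u < N → Adj graph u (apex a)
  path-apex-adj a u<N = edge⇒adj (<⇒≢ (<-≤-trans u<N (N≤apex a)) , inj₁ (inj₂ (N≤apex a)))

  connected : Connected graph
  connected u v =
    walk-below (N + m) (Adj-sym graph) (λ 1+u≡v _ → consecutive⇒adj (inj₁ 1+u≡v)) (λ _ → tt)
               (FinP.toℕ<n u) (FinP.toℕ<n v)

  InBag : Fin N → Fin (N + m) → Set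
  InBag t v = N ≤ toℕ v ⊎ (toℕ v ≡ toℕ t ⊎ suc (toℕ v) ≡ toℕ t)

  inBag? : ∀ t v → Dec (InBag t v)
  inBag? t v = N ≤? toℕ v ⊎-dec (toℕ v ≟ toℕ t ⊎-dec suc (toℕ v) ≟ toℕ t)

  bag : Fin N → Subset (N + m)
  bag t = subsetOf (inBag? t)

  pred-node<N : ∀ (t : Fin N) → pred (toℕ t) < N
  pred-node<N t = ≤-<-trans pred[n]≤n (FinP.toℕ<n t)

  bagCover : Fin N → Fin (2 + m) → Fin (N + m)
  bagCover t fzero           = pathVertex (FinP.toℕ<n t)
  bagCover t (fsuc fzero)    = pathVertex (pred-node<N t)
  bagCover t (fsuc (fsuc a)) = apex a

  bag-covered : ∀ t {v} → v ∈ bag t → ∃ λ i → bagCover t i ≡ v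
  bag-covered t v∈ with ∈-subsetOf⁻ (inBag? t) v∈
  ... | inj₁ N≤v with apex-view _ N≤v
  ...   | a , apex≡v = fsuc (fsuc a) , apex≡v
  bag-covered t v∈ | inj₂ (inj₁ v≡t)   = fzero , pathVertex-≡ (FinP.toℕ<n t) (sym v≡t)
  bag-covered t v∈ | inj₂ (inj₂ 1+v≡t) = fsuc fzero , pathVertex-≡ (pred-node<N t) (cong pred (sym 1+v≡t))

  treeNode : ∀ {v : Fin (N + m)} → toℕ v < N → Fin N
  treeNode v<N = fromℕ< v<N

  vertex-cover : 0 < N → ∀ v → ∃ λ t → v ∈ bag t
  vertex-cover 0<N v with N ≤? toℕ v
  ... | yes N≤v = fromℕ< 0<N , ∈-subsetOf⁺ (inBag? _) (inj₁ N≤v)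
  ... | no  N≰v = treeNode (≰⇒> N≰v) , ∈-subsetOf⁺ (inBag? _) (inj₂ (inj₁ (sym (FinP.toℕ-fromℕ< _))))

  module _ (0<N : 0 < N) where

    apex-edge-cover : ∀ {u} → N ≤ toℕ u → ∀ v → ∃ λ t → (u ∈ bag t × v ∈ bag t)
    apex-edge-cover N≤u v with vertex-cover 0<N v
    ... | t , v∈t = t , ∈-subsetOf⁺ (inBag? t) (inj₁ N≤u) , v∈t

    successor-edge-cover : ∀ u v → suc (toℕ u) ≡ toℕ v → ∃ λ t → (u ∈ bag t × v ∈ bag t)
    successor-edge-cover u v 1+u≡v with N ≤? toℕ v
    ... | yes N≤v = Data.Product.map₂ Data.Product.swap (apex-edge-cover N≤v u)
    ... | no  N≰v = treeNode (≰⇒> N≰v) ,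
        ∈-subsetOf⁺ (inBag? _) (inj₂ (inj₂ (trans 1+u≡v (sym (FinP.toℕ-fromℕ< _))))) ,
        ∈-subsetOf⁺ (inBag? _) (inj₂ (inj₁ (sym (FinP.toℕ-fromℕ< _))))

    edge-cover : ∀ u v → Adj graph u v → ∃ λ t → (u ∈ bag t × v ∈ bag t)
    edge-cover u v u~v with adj⇒edge u~v
    ... | _ , inj₁ (inj₁ N≤u)   = apex-edge-cover N≤u v
    ... | _ , inj₁ (inj₂ N≤v)   = Data.Product.map₂ Data.Product.swap (apex-edge-cover N≤v u)
    ... | _ , inj₂ (inj₁ 1+u≡v) = successor-edge-cover u v 1+u≡v
    ... | _ , inj₂ (inj₂ 1+v≡u) = Data.Product.map₂ Data.Product.swap (successor-edge-cover v u 1+v≡u)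

  same-or-consecutive : ∀ {x y z} → x ≡ y ⊎ suc x ≡ y → x ≡ z ⊎ suc x ≡ z → y ≡ z ⊎ Consecutive y z
  same-or-consecutive (inj₁ refl) (inj₁ refl) = inj₁ refl
  same-or-consecutive (inj₁ refl) (inj₂ refl) = inj₂ (inj₁ refl)
  same-or-consecutive (inj₂ refl) (inj₁ refl) = inj₂ (inj₂ refl)
  same-or-consecutive (inj₂ refl) (inj₂ refl) = inj₁ refl

  coherence : ∀ v t₁ t₂ → v ∈ bag t₁ → v ∈ bag t₂ → Walk (Adj (pathGraph N)) (λ t → v ∈ bag t) t₁ t₂
  coherence v t₁ t₂ v∈₁ v∈₂ with ∈-subsetOf⁻ (inBag? t₁) v∈₁ | ∈-subsetOf⁻ (inBag? t₂) v∈₂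
  ... | inj₁ N≤v | _        = pathGraph-walk (∈-subsetOf⁺ (inBag? _) (inj₁ N≤v)) t₁ t₂
  ... | inj₂ _   | inj₁ N≤v = pathGraph-walk (∈-subsetOf⁺ (inBag? _) (inj₁ N≤v)) t₁ t₂
  ... | inj₂ v~t₁ | inj₂ v~t₂ with same-or-consecutive v~t₁ v~t₂
  ...   | inj₁ t₁≡t₂ = subst (Walk _ _ t₁) (FinP.toℕ-injective t₁≡t₂) stay
  ...   | inj₂ t₁~t₂ = edge (pathGraph-adj⁺ t₁~t₂)

  treeDecomposition : 0 < N → TreeDecomposition graph (suc m)
  treeDecomposition 0<N = record
    { m              = N
    ; tree           = pathGraph N
    ; tree-connected = pathGraph-walk tt
    ; tree-acyclic   = pathGraph-acyclic
    ; bag            = bag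
    ; bag-size       = λ t → covered⇒∣p∣≤ (bag t) (bagCover t) (bag-covered t)
    ; vertex-cover   = vertex-cover 0<N
    ; edge-cover     = edge-cover 0<N
    ; coherence      = coherence
    }

data Ancestorℕ (parent : ℕ → Maybe ℕ) : ℕ → ℕ → Set where
  self : ∀ {u} → Ancestorℕ parent u u
  up   : ∀ {u v p} → parent v ≡ just p → Ancestorℕ parent u p → Ancestorℕ parent u v

ancestor-trans : ∀ {parent u p v} → Ancestorℕ parent u p → Ancestorℕ parent p v → Ancestorℕ parent u v
ancestor-trans u→p self       = u→p
ancestor-trans u→p (up e p→w) = up e (ancestor-trans u→p p→w)

record LabelForest (n q : ℕ) : Set where
  field
    parent      : ℕ → Maybe ℕ
    depth       : ℕ → ℕ
    parent-<    : ∀ {i p} → i < n → parent i ≡ just p → p < n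
    depth-root  : ∀ {i} → i < n → parent i ≡ nothing → depth i ≡ 1
    depth-child : ∀ {i p} → i < n → parent i ≡ just p → depth i ≡ suc (depth p)
    depth-≤     : ∀ {i} → i < n → depth i ≤ q

module _ {n q} (F : LabelForest n q) where
  open LabelForest F

  private
    parentAt : (v : Fin n) (mp : Maybe ℕ) → parent (toℕ v) ≡ mp → Maybe (Fin n)
    parentAt v nothing  _  = nothing
    parentAt v (just p) eq = just (fromℕ< (parent-< (FinP.toℕ<n v) eq))

    parentAt-view : ∀ v mp (eq : parent (toℕ v) ≡ mp) →
      (parentAt v mp eq ≡ nothing × mp ≡ nothing) ⊎ ∃ λ w → parentAt v mp eq ≡ just w × mp ≡ just (toℕ w)
    parentAt-view v nothing  eq = inj₁ (refl , refl)
    parentAt-view v (just p) eq = inj₂ (_ , refl , cong just (sym (FinP.toℕ-fromℕ< _)))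

  finParent : Fin n → Maybe (Fin n)
  finParent v = parentAt v (parent (toℕ v)) refl

  finParent-view : ∀ v → (finParent v ≡ nothing × parent (toℕ v) ≡ nothing)
                         ⊎ ∃ λ w → finParent v ≡ just w × parent (toℕ v) ≡ just (toℕ w)
  finParent-view v = parentAt-view v (parent (toℕ v)) refl

  finParent-nothing : ∀ v → finParent v ≡ nothing → parent (toℕ v) ≡ nothing
  finParent-nothing v eq with finParent-view v
  ... | inj₁ (_ , e)       = e
  ... | inj₂ (_ , e′ , _) = contradiction (trans (sym e′) eq) λ ()

  finParent-just : ∀ v w → finParent v ≡ just w → parent (toℕ v) ≡ just (toℕ w)
  finParent-just v w eq with finParent-view v
  ... | inj₁ (e′ , _)       = contradiction (trans (sym e′) eq) λ ()
  ... | inj₂ (w′ , e′ , e) = trans e (cong (just ∘ toℕ) (just-injective (trans (sym e′) eq)))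

  finAncestor : ∀ {i j} → Ancestorℕ parent i j → ∀ u v → toℕ u ≡ i → toℕ v ≡ j → Ancestor finParent u v
  finAncestor self u v refl v≡u = subst (Ancestor finParent u) (FinP.toℕ-injective (sym v≡u)) self
  finAncestor (up {p = p} e i→p) u v u≡i refl with finParent-view v
  ... | inj₁ (_ , e′)        = contradiction (trans (sym e′) e) λ ()
  ... | inj₂ (w , e′ , e″) = up e′ (finAncestor i→p u w u≡i (just-injective (trans (sym e″) e)))

  toElimForest : {G : Graph n} →
    (∀ u v → Adj G u v → Ancestorℕ parent (toℕ u) (toℕ v) ⊎ Ancestorℕ parent (toℕ v) (toℕ u)) →
    ElimForest G q
  toElimForest comparable = record
    { parent           = finParent
    ; depth            = depth ∘ toℕ
    ; depth-root       = λ v eq → depth-root (FinP.toℕ<n v) (finParent-nothing v eq)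
    ; depth-child      = λ v w eq → depth-child (FinP.toℕ<n v) (finParent-just v w eq)
    ; depth-bound      = λ v → depth-≤ (FinP.toℕ<n v)
    ; edges-comparable = λ u v u~v → Data.Sum.map (λ a → finAncestor a u v refl refl)
                                                  (λ a → finAncestor a v u refl refl) (comparable u v u~v)
    }

size : ℕ → ℕ
size zero    = 0
size (suc f) = suc (size f + size f)

suc-size : ∀ f → suc (size f) ≡ 2 ^ f
suc-size zero    = refl
suc-size (suc f) = begin
  suc (suc (size f + size f)) ≡⟨ cong suc (sym (+-suc (size f) (size f))) ⟩
  suc (size f) + suc (size f) ≡⟨ cong₂ _+_ (suc-size f) (trans (suc-size f) (sym (+-identityʳ _))) ⟩
  2 ^ f + (2 ^ f + 0)         ∎
  where open ≡-Reasoning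

InBlock : ℕ → ℕ → ℕ → Set
InBlock f lo i = lo ≤ i × i < lo + size f

empty-block : ∀ {lo i} → ¬ InBlock zero lo i
empty-block {lo} {i} (lo≤i , i<lo+0) = <⇒≱ (subst (i <_) (+-identityʳ lo) i<lo+0) lo≤i

module _ {f lo : ℕ} where

  private
    mid : ℕ
    mid = lo + size f

  mid-in-block : InBlock (suc f) lo mid
  mid-in-block = m≤m+n lo (size f) , +-monoʳ-< lo (s≤s (m≤m+n (size f) (size f)))

  right-end : suc mid + size f ≡ lo + size (suc f)
  right-end = trans (cong suc (+-assoc lo (size f) (size f))) (sym (+-suc lo _))

  left-block : ∀ {i} → InBlock (suc f) lo i → i < mid → InBlock f lo i
  left-block (lo≤i , _) i<mid = lo≤i , i<mid

  right-block : ∀ {i} → InBlock (suc f) lo i → mid < i → InBlock f (suc mid) i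
  right-block {i} (_ , i<end) mid<i = mid<i , subst (i <_) (sym right-end) i<end

  widen-left : ∀ {i} → InBlock f lo i → InBlock (suc f) lo i
  widen-left (lo≤i , i<mid) = lo≤i , <-trans i<mid (proj₂ mid-in-block)

  widen-right : ∀ {i} → InBlock f (suc mid) i → InBlock (suc f) lo i
  widen-right {i} (mid<i , i<end) = ≤-trans (proj₁ mid-in-block) (<⇒≤ mid<i) , subst (i <_) right-end i<end

-- Parent and depth of label i when lo, …, lo + size f − 1 are arranged in-order as a perfect binary
-- tree whose root gets parent p and depth suc d.
place : ℕ → ℕ → Maybe ℕ × ℕ → ℕ → Maybe ℕ × ℕ
place zero    lo ctx     i = ctx
place (suc f) lo (p , d) i with <-cmp i (lo + size f)
... | tri< _ _ _ = place f lo (just (lo + size f) , suc d) i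
... | tri≈ _ _ _ = p , suc d
... | tri> _ _ _ = place f (suc (lo + size f)) (just (lo + size f) , suc d) i

module _ (f lo : ℕ) (p : Maybe ℕ) (d : ℕ) where

  private
    mid : ℕ
    mid = lo + size f

  place-< : ∀ {i} → i < mid → place (suc f) lo (p , d) i ≡ place f lo (just mid , suc d) i
  place-< {i} i<mid with <-cmp i mid
  ... | tri< _ _ _     = refl
  ... | tri≈ i≮mid _ _ = contradiction i<mid i≮mid
  ... | tri> i≮mid _ _ = contradiction i<mid i≮mid

  place-mid : place (suc f) lo (p , d) mid ≡ (p , suc d)
  place-mid with <-cmp mid mid
  ... | tri< _ mid≢mid _ = contradiction refl mid≢mid
  ... | tri≈ _ _ _       = refl
  ... | tri> _ mid≢mid _ = contradiction refl mid≢mid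

  place-> : ∀ {i} → mid < i → place (suc f) lo (p , d) i ≡ place f (suc mid) (just mid , suc d) i
  place-> {i} mid<i with <-cmp i mid
  ... | tri< _ _ i≯mid = contradiction mid<i i≯mid
  ... | tri≈ _ _ i≯mid = contradiction mid<i i≯mid
  ... | tri> _ _ _     = refl

placement : ∀ f lo p d {i} → InBlock f lo i →
  place f lo (p , d) i ≡ (p , suc d)
  ⊎ ∃ λ j → ∃ λ dⱼ → InBlock f lo j × place f lo (p , d) i ≡ (just j , suc dⱼ) × proj₂ (place f lo (p , d) j) ≡ dⱼ
placement zero lo p d b = contradiction b empty-block
placement (suc f) lo p d {i} b with <-cmp i (lo + size f)
... | tri≈ _ _ _ = inj₁ refl
... | tri< i<mid _ _ with placement f lo (just (lo + size f)) (suc d) (left-block b i<mid)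
...   | inj₁ eq = inj₂ (_ , _ , mid-in-block , eq , cong proj₂ (place-mid f lo p d))
...   | inj₂ (j , _ , j∈ , eq , dⱼ) = inj₂ (j , _ , widen-left j∈ , eq , trans (cong proj₂ (place-< f lo p d (proj₂ j∈))) dⱼ)
placement (suc f) lo p d {i} b | tri> _ _ mid<i
  with placement f (suc (lo + size f)) (just (lo + size f)) (suc d) (right-block b mid<i)
...   | inj₁ eq = inj₂ (_ , _ , mid-in-block , eq , cong proj₂ (place-mid f lo p d))
...   | inj₂ (j , _ , j∈ , eq , dⱼ) = inj₂ (j , _ , widen-right j∈ , eq , trans (cong proj₂ (place-> f lo p d (proj₁ j∈))) dⱼ)

place-depth-≤ : ∀ f lo p d {i} → InBlock f lo i → proj₂ (place f lo (p , d) i) ≤ d + f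
place-depth-≤ zero lo p d b = contradiction b empty-block
place-depth-≤ (suc f) lo p d {i} b with <-cmp i (lo + size f)
... | tri< i<mid _ _ = ≤-trans (place-depth-≤ f lo _ (suc d) (left-block b i<mid)) (≤-reflexive (sym (+-suc d f)))
... | tri≈ _ _ _     = ≤-trans (s≤s (m≤m+n d f)) (≤-reflexive (sym (+-suc d f)))
... | tri> _ _ mid<i = ≤-trans (place-depth-≤ f _ _ (suc d) (right-block b mid<i)) (≤-reflexive (sym (+-suc d f)))

Agrees : (ℕ → Maybe ℕ) → ℕ → ℕ → Maybe ℕ × ℕ → Set
Agrees parent f lo ctx = ∀ {i} → InBlock f lo i → parent i ≡ proj₁ (place f lo ctx i)

module _ {parent : ℕ → Maybe ℕ} {f lo : ℕ} {p : Maybe ℕ} {d : ℕ}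
         (agrees : Agrees parent (suc f) lo (p , d)) where

  agrees-left : Agrees parent f lo (just (lo + size f) , suc d)
  agrees-left j∈ = trans (agrees (widen-left j∈)) (cong proj₁ (place-< f lo p d (proj₂ j∈)))

  agrees-right : Agrees parent f (suc (lo + size f)) (just (lo + size f) , suc d)
  agrees-right j∈ = trans (agrees (widen-right j∈)) (cong proj₁ (place-> f lo p d (proj₁ j∈)))

  parent-mid : parent (lo + size f) ≡ p
  parent-mid = trans (agrees mid-in-block) (cong proj₁ (place-mid f lo p d))

context-ancestor : ∀ {parent} f lo r d → Agrees parent f lo (just r , d) →
  ∀ {i} → InBlock f lo i → Ancestorℕ parent r i
context-ancestor zero lo r d agrees b = contradiction b empty-block
context-ancestor (suc f) lo r d agrees {i} b with <-cmp i (lo + size f)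
... | tri≈ _ refl _  = up (parent-mid agrees) self
... | tri< i<mid _ _ = ancestor-trans (up (parent-mid agrees) self)
                         (context-ancestor f lo _ (suc d) (agrees-left agrees) (left-block b i<mid))
... | tri> _ _ mid<i = ancestor-trans (up (parent-mid agrees) self)
                         (context-ancestor f _ _ (suc d) (agrees-right agrees) (right-block b mid<i))

consecutive-comparable : ∀ {parent} f lo ctx → Agrees parent f lo ctx →
  ∀ {i} → InBlock f lo i → InBlock f lo (suc i) → Ancestorℕ parent i (suc i) ⊎ Ancestorℕ parent (suc i) i
consecutive-comparable zero lo ctx agrees b _ = contradiction b empty-block
consecutive-comparable {parent} (suc f) lo (p , d) agrees {i} b b′ with <-cmp i (lo + size f)
... | tri≈ _ refl _  = inj₁ (context-ancestor f _ _ (suc d) (agrees-right agrees) (right-block b′ ≤-refl))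
... | tri> _ _ mid<i =
  consecutive-comparable f _ _ (agrees-right agrees) (right-block b mid<i) (right-block b′ (m<n⇒m<1+n mid<i))
... | tri< i<mid _ _ with <-cmp (suc i) (lo + size f)
...   | tri< 1+i<mid _ _ =
          consecutive-comparable f lo _ (agrees-left agrees) (left-block b i<mid) (left-block b′ 1+i<mid)
...   | tri≈ _ 1+i≡mid _ = inj₂ (subst (λ x → Ancestorℕ parent x i) (sym 1+i≡mid)
                              (context-ancestor f lo _ (suc d) (agrees-left agrees) (left-block b i<mid)))
...   | tri> _ _ mid<1+i = contradiction (m<1+n⇒m≤n mid<1+i) (<⇒≱ i<mid)

module ApexPathForest (e m : ℕ) where

  open ApexPath (size e) m using (Edge; graph; adj⇒edge)

  private
    N : ℕ
    N = size e

  chainParent : ℕ → Maybe ℕ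
  chainParent zero    = nothing
  chainParent (suc j) = just (N + j)

  pathContext : Maybe ℕ × ℕ
  pathContext = chainParent m , m

  slot : ℕ → Maybe ℕ × ℕ
  slot i with i <? N
  ... | yes _ = place e 0 pathContext i
  ... | no  _ = chainParent (i ∸ N) , suc (i ∸ N)

  parent : ℕ → Maybe ℕ
  parent = proj₁ ∘ slot

  depth : ℕ → ℕ
  depth = proj₂ ∘ slot

  slot-path : ∀ {i} → i < N → slot i ≡ place e 0 pathContext i
  slot-path {i} i<N with i <? N
  ... | yes _   = refl
  ... | no  i≮N = contradiction i<N i≮N

  slot-apex : ∀ j → slot (N + j) ≡ (chainParent j , suc j)
  slot-apex j with N + j <? N
  ... | yes N+j<N = contradiction (m≤m+n N j) (<⇒≱ N+j<N)
  ... | no  _     = cong (λ x → chainParent x , suc x) (m+n∸m≡n N j)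

  label-view : ∀ {i} → i < N + m → i < N ⊎ ∃ λ j → j < m × i ≡ N + j
  label-view {i} i<n with i <? N
  ... | yes i<N = inj₁ i<N
  ... | no  i≮N = inj₂ (i ∸ N , +-cancelˡ-< N _ _ (subst (_< N + m) (sym N+[i∸N]≡i) i<n) , sym N+[i∸N]≡i)
    where
    N+[i∸N]≡i : N + (i ∸ N) ≡ i
    N+[i∸N]≡i = m+[n∸m]≡n (≮⇒≥ i≮N)

  path-agrees : Agrees parent e 0 pathContext
  path-agrees i∈ = cong proj₁ (slot-path (proj₂ i∈))

  slot-view : ∀ {i} → i < N + m →
    (∃ λ j → j ≤ m × slot i ≡ (chainParent j , suc j)) ⊎ ∃ λ j → j < N × slot i ≡ (just j , suc (depth j))
  slot-view {i} i<n with label-view i<n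
  ... | inj₂ (j , j<m , refl) = inj₁ (j , <⇒≤ j<m , slot-apex j)
  ... | inj₁ i<N with placement e 0 (chainParent m) m (z≤n , i<N)
  ...   | inj₁ eq = inj₁ (m , ≤-refl , trans (slot-path i<N) eq)
  ...   | inj₂ (j , _ , (_ , j<N) , eq , dⱼ) = inj₂ (j , j<N , (begin
            slot i                          ≡⟨ slot-path i<N ⟩
            place e 0 pathContext i         ≡⟨ eq ⟩
            (just j , suc _)                ≡⟨ cong (λ x → just j , suc x) (trans (cong proj₂ (slot-path j<N)) dⱼ) ⟨
            (just j , suc (depth j))        ∎))
    where open ≡-Reasoning

  chainParent-< : ∀ {j p} → j ≤ m → chainParent j ≡ just p → p < N + m
  chainParent-< {suc j} 1+j≤m refl = +-monoʳ-< N 1+j≤m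

  chainParent-depth : ∀ {j p} → chainParent j ≡ just p → j ≡ depth p
  chainParent-depth {suc j} refl = sym (cong proj₂ (slot-apex j))

  chainParent-nothing : ∀ {j} → chainParent j ≡ nothing → j ≡ 0
  chainParent-nothing {zero} _ = refl

  lowest-link : ∀ {j} k → j < k → chainParent k ≡ just (N + pred k) × j ≤ pred k
  lowest-link (suc k) (s≤s j≤k) = refl , j≤k

  chain-ancestor : ∀ {j} j′ → j ≤ j′ → Ancestorℕ parent (N + j) (N + j′)
  chain-ancestor j′ j≤j′ with m≤n⇒m<n∨m≡n j≤j′
  ... | inj₂ refl = self
  chain-ancestor (suc j′) _ | inj₁ (s≤s j≤j′) =
    up (cong proj₁ (slot-apex (suc j′))) (chain-ancestor j′ j≤j′)

  apex-above-path : ∀ {j i} → j < m → i < N → Ancestorℕ parent (N + j) i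
  apex-above-path j<m i<N with lowest-link m j<m
  ... | eq , j≤pred-m = ancestor-trans (chain-ancestor _ j≤pred-m)
          (context-ancestor e 0 _ m (subst (λ p → Agrees parent e 0 (p , m)) eq path-agrees) (z≤n , i<N))

  Comparable : ℕ → ℕ → Set
  Comparable i j = Ancestorℕ parent i j ⊎ Ancestorℕ parent j i

  path-comparable : ∀ {i j} → i < N → j < N → suc i ≡ j → Comparable i j
  path-comparable i<N j<N refl = consecutive-comparable e 0 pathContext path-agrees (z≤n , i<N) (z≤n , j<N)

  edge-comparable : ∀ {i j} → i < N + m → j < N + m → Edge i j → Comparable i j
  edge-comparable i<n j<n i~j with label-view i<n | label-view j<n
  ... | inj₂ (a , _ , refl) | inj₂ (b , _ , refl) with ≤-total a b
  ...   | inj₁ a≤b = inj₁ (chain-ancestor b a≤b)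
  ...   | inj₂ b≤a = inj₂ (chain-ancestor a b≤a)
  edge-comparable _ _ _ | inj₂ (a , a<m , refl) | inj₁ j<N = inj₁ (apex-above-path a<m j<N)
  edge-comparable _ _ _ | inj₁ i<N | inj₂ (b , b<m , refl) = inj₂ (apex-above-path b<m i<N)
  edge-comparable _ _ (_ , inj₁ (inj₁ N≤i)) | inj₁ i<N | inj₁ _ = contradiction N≤i (<⇒≱ i<N)
  edge-comparable _ _ (_ , inj₁ (inj₂ N≤j)) | inj₁ _ | inj₁ j<N = contradiction N≤j (<⇒≱ j<N)
  edge-comparable _ _ (_ , inj₂ (inj₁ 1+i≡j)) | inj₁ i<N | inj₁ j<N = path-comparable i<N j<N 1+i≡j
  edge-comparable _ _ (_ , inj₂ (inj₂ 1+j≡i)) | inj₁ i<N | inj₁ j<N =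
    Data.Sum.swap (path-comparable j<N i<N 1+j≡i)

  labelForest : ∀ {q} → m + e ≤ q → LabelForest (N + m) q
  labelForest {q} m+e≤q = record
    { parent      = parent
    ; depth       = depth
    ; parent-<    = parent-<
    ; depth-root  = depth-root
    ; depth-child = depth-child
    ; depth-≤     = depth-≤
    }
    where
    parent-< : ∀ {i p} → i < N + m → parent i ≡ just p → p < N + m
    parent-< i<n eq with slot-view i<n
    ... | inj₁ (j , j≤m , slot≡) = chainParent-< j≤m (trans (sym (cong proj₁ slot≡)) eq)
    ... | inj₂ (j , j<N , slot≡) with trans (sym (cong proj₁ slot≡)) eq
    ...   | refl = <-≤-trans j<N (m≤m+n N m)

    depth-root : ∀ {i} → i < N + m → parent i ≡ nothing → depth i ≡ 1
    depth-root i<n eq with slot-view i<n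
    ... | inj₁ (j , _ , slot≡) =
          trans (cong proj₂ slot≡) (cong suc (chainParent-nothing (trans (sym (cong proj₁ slot≡)) eq)))
    ... | inj₂ (_ , _ , slot≡) = contradiction (trans (sym (cong proj₁ slot≡)) eq) λ ()

    depth-child : ∀ {i p} → i < N + m → parent i ≡ just p → depth i ≡ suc (depth p)
    depth-child i<n eq with slot-view i<n
    ... | inj₁ (j , _ , slot≡) =
          trans (cong proj₂ slot≡) (cong suc (chainParent-depth (trans (sym (cong proj₁ slot≡)) eq)))
    ... | inj₂ (j , _ , slot≡) with trans (sym (cong proj₁ slot≡)) eq
    ...   | refl = cong proj₂ slot≡

    depth-≤ : ∀ {i} → i < N + m → depth i ≤ q
    depth-≤ i<n with label-view i<n
    ... | inj₁ i<N =
          ≤-trans (subst (_≤ m + e) (sym (cong proj₂ (slot-path i<N))) (place-depth-≤ e 0 _ m (z≤n , i<N))) m+e≤q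
    ... | inj₂ (j , j<m , refl) =
          ≤-trans (≤-reflexive (cong proj₂ (slot-apex j))) (≤-trans j<m (≤-trans (m≤m+n m e) m+e≤q))

  elimForest : ∀ {q} → m + e ≤ q → ElimForest graph q
  elimForest m+e≤q = toElimForest (labelForest m+e≤q)
    (λ u v u~v → edge-comparable (FinP.toℕ<n u) (FinP.toℕ<n v) (adj⇒edge u~v))

↑ˡ-adj : ∀ {n} (G : Graph n) k {u v} → Adj G u v → AdjG' G k (u ↑ˡ k) (v ↑ˡ k)
↑ˡ-adj {n} G k {u} {v} u~v rewrite FinP.splitAt-↑ˡ n u k | FinP.splitAt-↑ˡ n v k = u~v

↑ˡ∉cliqueK : ∀ {n} (G : Graph n) k v → (v ↑ˡ k) ∉ cliqueK G k
↑ˡ∉cliqueK {n} G k v v∈K = contradiction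
  (trans (sym (trans (lookup-++ˡ (replicate n false) _ v) (lookup-replicate v false))) ([]=⇒lookup v∈K)) λ ()

↑ˡ-labels-injective : ∀ {j n} k (g : Fin j → Fin n) (ℓ : Fin j → ℕ) → (∀ i → toℕ (g i) ≡ ℓ i) →
  Injective _≡_ _≡_ ℓ → Injective _≡_ _≡_ (λ i → g i ↑ˡ k)
↑ˡ-labels-injective k g ℓ g≗ℓ ℓ-inj {i} {j} eq =
  ℓ-inj (trans (sym (g≗ℓ i)) (trans (cong toℕ (FinP.↑ˡ-injective k _ _ eq)) (g≗ℓ j)))

↑ˡ-label-≢ : ∀ {n} k {u v : Fin n} → toℕ u ≢ toℕ v → u ↑ˡ k ≢ v ↑ˡ k
↑ˡ-label-≢ k u≢v eq = u≢v (cong toℕ (FinP.↑ˡ-injective k _ _ eq))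

module _ {n} (G : Graph n) (k : ℕ) (Safe : ℕ → Fin n → Set) where

  Move : ℕ → Subset (n + k) → Subset (n + k) → Fin n → Set
  Move r X Y v = Σ (Fin n) λ w →
    Walk (AdjG' G k) (λ x → x ∉ X ∩ Y) (v ↑ˡ k) (w ↑ˡ k) × (w ↑ˡ k) ∉ Y × Safe r w

  Evasion : Set
  Evasion = ∀ {r X v} → Safe (suc r) v → (v ↑ˡ k) ∉ X →
    ∀ Y → ∣ Y ∣ ≡ k → ∣ X ∩ Y ∣ ≡ k ∸ 1 → Move r X Y v

  survives : Evasion → ∀ r {X v} → Safe r v → (v ↑ˡ k) ∉ X → RobberSurvives G k r X v
  survives evade zero    _    _   = tt
  survives evade (suc r) safe v∉X Y ∣Y∣≡k ∣X∩Y∣≡k-1 with evade safe v∉X Y ∣Y∣≡k ∣X∩Y∣≡k-1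
  ... | w , v⇝w , w∉Y , safe′ = w , v⇝w , w∉Y , survives evade r safe′ w∉Y

module ApexPathRobber (N m q : ℕ) (room : q + (2 + m) + q ≤ N) where

  open ApexPath N m

  Safe : ℕ → Fin (N + m) → Set
  Safe r v = r ≤ q × r ≤ toℕ v × toℕ v + r < N

  safe-pathVertex : ∀ {r i} (i<N : i < N) → r ≤ q → r ≤ i → i + r < N → Safe r (pathVertex i<N)
  safe-pathVertex i<N r≤q r≤i i+r<N rewrite toℕ-pathVertex i<N = r≤q , r≤i , i+r<N

  stay-safe : ∀ {r v} → Safe (suc r) v → Safe r v
  stay-safe (1+r≤q , 1+r≤v , v+1+r<N) = <⇒≤ 1+r≤q , <⇒≤ 1+r≤v , ≤-<-trans (+-monoʳ-≤ _ (n≤1+n _)) v+1+r<N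

  module _ {w : ℕ} (1+w<N : suc w < N) where

    pred<suc : pred w < suc w
    pred<suc = s≤s pred[n]≤n

    pred<N : pred w < N
    pred<N = <-trans pred<suc 1+w<N

    escapeLabel : Fin (2 + m) → ℕ
    escapeLabel fzero           = pred w
    escapeLabel (fsuc fzero)    = suc w
    escapeLabel (fsuc (fsuc a)) = N + toℕ a

    escapeVertex : Fin (2 + m) → Fin (N + m)
    escapeVertex fzero           = pathVertex pred<N
    escapeVertex (fsuc fzero)    = pathVertex 1+w<N
    escapeVertex (fsuc (fsuc a)) = apex a

    toℕ-escapeVertex : ∀ i → toℕ (escapeVertex i) ≡ escapeLabel i
    toℕ-escapeVertex fzero           = toℕ-pathVertex pred<N
    toℕ-escapeVertex (fsuc fzero)    = toℕ-pathVertex 1+w<N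
    toℕ-escapeVertex (fsuc (fsuc a)) = FinP.toℕ-↑ʳ N a

    path≢apex : ∀ {x} b → x < N → x ≢ N + b
    path≢apex b x<N = <⇒≢ (<-≤-trans x<N (m≤m+n N b))

    escapeLabel-injective : Injective _≡_ _≡_ escapeLabel
    escapeLabel-injective {fzero}         {fzero}         _  = refl
    escapeLabel-injective {fsuc fzero}    {fsuc fzero}    _  = refl
    escapeLabel-injective {fsuc (fsuc a)} {fsuc (fsuc b)} eq =
      cong (fsuc ∘ fsuc) (FinP.toℕ-injective (+-cancelˡ-≡ N _ _ eq))
    escapeLabel-injective {fzero}         {fsuc fzero}    eq = contradiction eq (<⇒≢ pred<suc)
    escapeLabel-injective {fsuc fzero}    {fzero}         eq = contradiction (sym eq) (<⇒≢ pred<suc)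
    escapeLabel-injective {fzero}         {fsuc (fsuc b)} eq = contradiction eq (path≢apex _ pred<N)
    escapeLabel-injective {fsuc (fsuc a)} {fzero}         eq = contradiction (sym eq) (path≢apex _ pred<N)
    escapeLabel-injective {fsuc fzero}    {fsuc (fsuc b)} eq = contradiction eq (path≢apex _ 1+w<N)
    escapeLabel-injective {fsuc (fsuc a)} {fsuc fzero}    eq = contradiction (sym eq) (path≢apex _ 1+w<N)

  module Jump {r} (r<q : r < q) where

    fits : ∀ (i : Fin (3 + m)) → q + toℕ i + r < N
    fits i = <-≤-trans (+-mono-≤-< (+-monoʳ-≤ q (m<1+n⇒m≤n (FinP.toℕ<n i))) r<q) room

    window<N : ∀ i → q + toℕ i < N
    window<N i = ≤-<-trans (m≤m+n _ r) (fits i)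

    window : Fin (3 + m) → Fin (N + m)
    window i = pathVertex (window<N i)

    window-injective : Injective _≡_ _≡_ (λ i → window i ↑ˡ (2 + m))
    window-injective = ↑ˡ-labels-injective (2 + m) window (λ i → q + toℕ i) (toℕ-pathVertex ∘ window<N)
                         (FinP.toℕ-injective ∘ +-cancelˡ-≡ q _ _)

    jump : ∀ {X Y v} → toℕ v < N → ∣ Y ∣ ≡ 2 + m →
      ∀ a → (apex a ↑ˡ (2 + m)) ∉ X ∩ Y → Move graph (2 + m) Safe r X Y v
    jump {Y = Y} v<N ∣Y∣≡k a apex∉X∩Y
      with injection-misses Y (λ i → window i ↑ˡ (2 + m)) window-injective (subst (_< 3 + m) (sym ∣Y∣≡k) ≤-refl)
    ... | i , window∉Y =
      window i ,
      step (↑ˡ-adj graph _ (path-apex-adj a v<N)) apex∉X∩Y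
           (edge (↑ˡ-adj graph _ (Adj-sym graph (path-apex-adj a (toℕ-pathVertex<N (window<N i)))))) ,
      window∉Y ,
      safe-pathVertex (window<N i) (<⇒≤ r<q) (≤-trans (<⇒≤ r<q) (m≤m+n q _)) (fits i)

  module Neighbours {r v} (safe : Safe (suc r) v) where

    private
      w : ℕ
      w = toℕ v
      1+r≤v : suc r ≤ w
      1+r≤v = proj₁ (proj₂ safe)
      v+1+r<N : w + suc r < N
      v+1+r<N = proj₂ (proj₂ safe)

    v+r<N : w + r < N
    v+r<N = ≤-<-trans (+-monoʳ-≤ w (n≤1+n r)) v+1+r<N

    v<N : w < N
    v<N = ≤-<-trans (m≤m+n w r) v+r<N

    1+v<N : suc w < N
    1+v<N = ≤-<-trans (s≤s (m≤m+n w r)) (subst (_< N) (+-suc w r) v+1+r<N)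

    suc-pred-v : suc (pred w) ≡ w
    suc-pred-v = suc-pred w {{>-nonZero (≤-trans (s≤s z≤n) 1+r≤v)}}

    left right : Fin (N + m)
    left  = escapeVertex 1+v<N fzero
    right = escapeVertex 1+v<N (fsuc fzero)

    left~v : Adj graph left v
    left~v = consecutive⇒adj (inj₁ (trans (cong suc (toℕ-escapeVertex 1+v<N fzero)) suc-pred-v))

    v~right : Adj graph v right
    v~right = consecutive⇒adj (inj₁ (sym (toℕ-escapeVertex 1+v<N (fsuc fzero))))

    left≢v : toℕ left ≢ w
    left≢v eq = 1+n≢n (trans (cong suc (trans (sym eq) (toℕ-escapeVertex 1+v<N fzero))) suc-pred-v)

    right≢v : toℕ right ≢ w
    right≢v eq = 1+n≢n (trans (sym (toℕ-escapeVertex 1+v<N (fsuc fzero))) eq)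

    safe-left : Safe r left
    safe-left = safe-pathVertex (pred<N 1+v<N) (<⇒≤ (proj₁ safe)) (suc[m]≤n⇒m≤pred[n] 1+r≤v)
                  (≤-<-trans (+-monoˡ-≤ r pred[n]≤n) v+r<N)

    safe-right : Safe r right
    safe-right = safe-pathVertex 1+v<N (<⇒≤ (proj₁ safe)) (m≤n⇒m≤1+n (<⇒≤ 1+r≤v))
                   (subst (_< N) (+-suc w r) v+1+r<N)

    respond : ∀ {X} → (v ↑ˡ (2 + m)) ∉ X →
      ∀ Y → ∣ Y ∣ ≡ 2 + m → ∣ X ∩ Y ∣ ≡ suc m → Move graph (2 + m) Safe r X Y v
    respond {X} v∉X Y ∣Y∣≡k ∣X∩Y∣≡k-1 with (v ↑ˡ (2 + m)) ∈? Y
    ... | no  v∉Y = v , stay , v∉Y , stay-safe safe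
    ... | yes v∈Y with injection-misses (X ∩ Y) (λ i → escapeVertex 1+v<N i ↑ˡ (2 + m))
                         (↑ˡ-labels-injective (2 + m) _ _ (toℕ-escapeVertex 1+v<N) (escapeLabel-injective 1+v<N))
                         (subst (_< 2 + m) (sym ∣X∩Y∣≡k-1) ≤-refl)
    ...   | fzero , left∉X∩Y =
            left , edge (↑ˡ-adj graph _ (Adj-sym graph left~v)) ,
            ∉X∩Y⇒∉Y ∣Y∣≡k ∣X∩Y∣≡k-1 v∈Y v∉X (↑ˡ-label-≢ _ left≢v) left∉X∩Y , safe-left
    ...   | fsuc fzero , right∉X∩Y =
            right , edge (↑ˡ-adj graph _ v~right) ,
            ∉X∩Y⇒∉Y ∣Y∣≡k ∣X∩Y∣≡k-1 v∈Y v∉X (↑ˡ-label-≢ _ right≢v) right∉X∩Y , safe-right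
    ...   | fsuc (fsuc a) , apex∉X∩Y = Jump.jump (proj₁ safe) v<N ∣Y∣≡k a apex∉X∩Y

  robberWins : RobberWins graph (2 + m) q
  robberWins =
    start , survives graph (2 + m) Safe (λ safe → Neighbours.respond safe) q (safe-pathVertex q<N ≤-refl ≤-refl q+q<N) (↑ˡ∉cliqueK graph _ start)
    where
    q+q<N : q + q < N
    q+q<N = <-≤-trans (+-monoˡ-< q (m<m+n q (s≤s z≤n))) room
    q<N : q < N
    q<N = ≤-<-trans (m≤m+n q q) q+q<N
    start : Fin (N + m)
    start = pathVertex q<N

exponent-split : ∀ {q m} → 0 < q → (8 * q) ^ suc m ≤ 2 ^ q → m ≤ q × 8 * q ≤ 2 ^ (q ∸ m)
exponent-split {q@(suc _)} {m} z<s hyp = m≤q , 8q≤2^[q∸m]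
  where
  2≤8q : 2 ≤ 8 * q
  2≤8q = ≤-trans (s≤s (s≤s z≤n)) (*-monoʳ-≤ 8 (s≤s z≤n))
  8q*2^m≤2^q : 8 * q * 2 ^ m ≤ 2 ^ q
  8q*2^m≤2^q = ≤-trans (*-monoʳ-≤ (8 * q) (^-monoˡ-≤ m 2≤8q)) hyp
  m≤q : m ≤ q
  m≤q = ≮⇒≥ λ q<m → <⇒≱ (^-monoʳ-< 2 (s≤s (s≤s z≤n)) q<m) (≤-trans (m≤n*m (2 ^ m) (8 * q)) 8q*2^m≤2^q)
  8q≤2^[q∸m] : 8 * q ≤ 2 ^ (q ∸ m)
  8q≤2^[q∸m] = *-cancelˡ-≤ (2 ^ m) {{m^n≢0 2 m}} (begin
    2 ^ m * (8 * q)     ≡⟨ *-comm (2 ^ m) (8 * q) ⟩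
    8 * q * 2 ^ m       ≤⟨ 8q*2^m≤2^q ⟩
    2 ^ q               ≡⟨ cong (2 ^_) (sym (m+[n∸m]≡n m≤q)) ⟩
    2 ^ (m + (q ∸ m))   ≡⟨ ^-distribˡ-+-* 2 m (q ∸ m) ⟩
    2 ^ m * 2 ^ (q ∸ m) ∎)
    where open ≤-Reasoning

3q+3+[5q∸3]≡8q : ∀ q′ → suc (suc q′ + (2 + suc q′) + suc q′) + (2 + 5 * q′) ≡ 8 * suc q′
3q+3+[5q∸3]≡8q = solve-∀

robber-room : ∀ {q m e} → 0 < q → m ≤ q → 8 * q ≤ 2 ^ e → q + (2 + m) + q ≤ size e
robber-room {q@(suc q′)} {m} {e} z<s m≤q 8q≤2^e = ≤-pred (begin
  suc (q + (2 + m) + q) ≤⟨ s≤s (+-monoˡ-≤ q (+-monoʳ-≤ q (s≤s (s≤s m≤q)))) ⟩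
  suc (q + (2 + q) + q) ≤⟨ m≤m+n _ (2 + 5 * q′) ⟩
  suc (q + (2 + q) + q) + (2 + 5 * q′) ≡⟨ 3q+3+[5q∸3]≡8q q′ ⟩
  8 * q                 ≤⟨ 8q≤2^e ⟩
  2 ^ e                 ≡⟨ suc-size e ⟨
  suc (size e)          ∎)
  where open ≤-Reasoning

apexedPath-witness : ∀ q m e → m + e ≤ q → q + (2 + m) + q ≤ size e →
  Σ ℕ λ n → Σ (Graph n) λ G →
    Connected G × TreeDecomposition G (suc m) × ElimForest G q × RobberWins G (2 + m) q
apexedPath-witness q m e m+e≤q room =
  size e + m , graph , connected , treeDecomposition 0<N ,
  ApexPathForest.elimForest e m m+e≤q , ApexPathRobber.robberWins (size e) m q room
  where
  open ApexPath (size e) m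
  0<N : 0 < size e
  0<N = <-≤-trans (s≤s z≤n) (≤-trans (m≤n+m (2 + m) q) (≤-trans (m≤m+n _ q) room))

lemma38 : (q k : ℕ) → 3 ≤ q → 3 ≤ k → (8 * q) ^ (k ∸ 1) ≤ 2 ^ q →
    (Σ ℕ λ n → Σ (Graph n) λ G →
       Connected G × TreeDecomposition G (k ∸ 1) × ElimForest G q × RobberWins G k q)
    × (Σ ℕ λ n → Σ (Graph n) λ G →
       Connected G × TreeDecomposition G 1 × ElimForest G q × RobberWins G 2 q)
lemma38 q (suc (suc (suc m))) 3≤q _ hyp =
    apexedPath-witness q (suc m) (q ∸ suc m) (≤-reflexive (m+[n∸m]≡n 1+m≤q)) (robber-room 0<q 1+m≤q 8q≤2^[q∸1∸m])
  , apexedPath-witness q 0 q ≤-refl (robber-room 0<q z≤n (≤-trans 8q≤2^[q∸1∸m] (^-monoʳ-≤ 2 (m∸n≤m q (suc m)))))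
  where
  0<q : 0 < q
  0<q = ≤-trans (s≤s z≤n) 3≤q
  1+m≤q : suc m ≤ q
  1+m≤q = proj₁ (exponent-split 0<q hyp)
  8q≤2^[q∸1∸m] : 8 * q ≤ 2 ^ (q ∸ suc m)
  8q≤2^[q∸1∸m] = proj₂ (exponent-split 0<q hyp)
lemma38 q (suc (suc zero)) _ (s≤s (s≤s ())) _
lemma38 q (suc zero)       _ (s≤s ())       _
lemma38 q zero             _ ()             _
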